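{- Let $G$ be a finite directed multigraph without loops on vertex set $\{1,\dots,n+1\}$ having a global sink at vertex $n+1$, with reduced Laplacian $\Delta$. Let $\sigma^M$ be the minimum $G$-strongly positive script and let $\mathbf a$ be a stable configuration. The following are equivalent: (i) $\mathbf a$ is superstable; (ii) $\mathbf a-\sigma\Delta$ has a negative component for every $\sigma\in\mathbb N^n$ with $\mathbf 0\prec\sigma\preceq\sigma^M$; (iii) $\mathbf a-\sigma\Delta$ is not stable for every $\sigma\in\mathbb N^n$ with $\mathbf 0\prec\sigma\preceq\sigma^M$.
   Context: $G=(V,E)$ is a directed multigraph without loops, $V=\{1,\dots,n+1\}$; $d^+_i$ is the out-degree of $i$ and $e_{i,j}$ the number of edges from $i$ to $j$. Vertex $n+1$ is a global sink: it has no out-going edges and every other vertex has a directed path to it. The reduced Laplacian $\Delta\in\mathbb Z^{n\times n}$ has $\Delta_{ii}=d^+_i$ and $\Delta_{ij}=-e_{i,j}$ for $i\ne j$ ($i,j\le n$). Vectors are row vectors. A configuration is a vector in $\mathbb Z^n$. Vertex $i$ is active in $\mathbf a$ if $a_i\ge d^+_i$. A stable configuration is a non-negative configuration with no active vertex. Containment order: $a\succeq b$ iff $a_i\ge b_i$ for all $i$; $a\succ b$ means $a\succeq b$ and $a\ne b$. A non-negative configuration $\mathbf a$ is superstable if for every $\sigma\in\mathbb N^n$ with $\sigma\succ\mathbf 0$, $\mathbf a-\sigma\Delta$ has a negative component. A source component of $G$ is a strongly connected component with no edge entering it from another strongly connected component. An $n$-script $\sigma\in\mathbb N^n$ is $G$-positive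 if $\sigma\Delta\succ\mathbf 0$, and $G$-strongly positive if it is $G$-positive and the support $\{i:(\sigma\Delta)_i\ne0\}$ intersects every source component of $G$. There is a unique minimum (with respect to $\preceq$) $G$-strongly positive script, denoted $\sigma^M$. -}

module Defs where

open import Data.Nat as ℕ using (ℕ; zero; suc)
open import Data.Integer as ℤ using (ℤ; +_; _-_; _*_; _<_; _≤_)
open import Data.Fin using (Fin; zero; suc; inject₁; fromℕ; _≟_)
open import Data.Product using (Σ; ∃; _×_; _,_)
open import Relation.Binary.PropositionalEquality using (_≡_; _≢_)
open import Relation.Nullary using (¬_; yes; no)

sumℕ : ∀ {n} → (Fin n → ℕ) → ℕ
sumℕ {zero}  f = 0
sumℕ {suc n} f = f zero ℕ.+ sumℕ (λ i → f (suc i))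

sumℤ : ∀ {n} → (Fin n → ℤ) → ℤ
sumℤ {zero}  f = + 0
sumℤ {suc n} f = f zero ℤ.+ sumℤ (λ i → f (suc i))

-- A directed multigraph on vertex set Fin (suc n) (vertices 1..n+1;
-- vertex i ≤ n is  inject₁ i, vertex n+1 is  fromℕ n), given by edge
-- multiplicities  e u v  = number of edges from u to v.
Multigraph : ℕ → Set
Multigraph n = Fin (suc n) → Fin (suc n) → ℕ

sink : (n : ℕ) → Fin (suc n)
sink n = fromℕ n

data Reach {n : ℕ} (e : Multigraph n) : Fin (suc n) → Fin (suc n) → Set where
  here : ∀ {u} → Reach e u u
  step : ∀ {u x w} → 0 ℕ.< e u x → Reach e x w → Reach e u w

NoLoops : ∀ {n} → Multigraph n → Set
NoLoops {n} e = ∀ (v : Fin (suc n)) → e v v ≡ 0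

GlobalSink : ∀ {n} → Multigraph n → Set
GlobalSink {n} e =
  (∀ (v : Fin (suc n)) → e (sink n) v ≡ 0) × (∀ (v : Fin (suc n)) → Reach e v (sink n))

outdeg : ∀ {n} → Multigraph n → Fin n → ℕ
outdeg {n} e i = sumℕ (λ j → e (inject₁ i) j)

Laplacian : ∀ {n} → Multigraph n → Fin n → Fin n → ℤ
Laplacian e i j with i ≟ j
... | yes _ = + outdeg e i
... | no  _ = ℤ.- (+ e (inject₁ i) (inject₁ j))

Config : ℕ → Set
Config n = Fin n → ℤ

Script : ℕ → Set
Script n = Fin n → ℕ

_·Δ[_] : ∀ {n} → Script n → Multigraph n → Config n
(σ ·Δ[ e ]) j = sumℤ (λ i → + σ i * Laplacian e i j)

_⊖_ : ∀ {n} → Config n → Config n → Config n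
(a ⊖ b) i = a i - b i

_≽ℕ_ : ∀ {n} → Script n → Script n → Set
a ≽ℕ b = ∀ i → b i ℕ.≤ a i

_≻ℕ_ : ∀ {n} → Script n → Script n → Set
a ≻ℕ b = (a ≽ℕ b) × ¬ (∀ i → a i ≡ b i)

_≽ℤ_ : ∀ {n} → Config n → Config n → Set
a ≽ℤ b = ∀ i → b i ≤ a i

_≻ℤ_ : ∀ {n} → Config n → Config n → Set
a ≻ℤ b = (a ≽ℤ b) × ¬ (∀ i → a i ≡ b i)

0ℕ : ∀ {n} → Script n
0ℕ _ = 0

0ℤ : ∀ {n} → Config n
0ℤ _ = + 0

NonNeg : ∀ {n} → Config n → Set
NonNeg a = ∀ i → + 0 ≤ a i

HasNegative : ∀ {n} → Config n → Set
HasNegative a = ∃ λ i → a i < + 0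

Stable : ∀ {n} → Multigraph n → Config n → Set
Stable e a = NonNeg a × (∀ i → a i < + outdeg e i)

Superstable : ∀ {n} → Multigraph n → Config n → Set
Superstable e a = NonNeg a × (∀ (σ : Script _) → σ ≻ℕ 0ℕ → HasNegative (a ⊖ (σ ·Δ[ e ])))

SameSCC : ∀ {n} → Multigraph n → Fin (suc n) → Fin (suc n) → Set
SameSCC e u v = Reach e u v × Reach e v u

IsSourceComponentOf : ∀ {n} → Multigraph n → Fin (suc n) → Set
IsSourceComponentOf {n} e v =
  ∀ (u w : Fin (suc n)) → 0 ℕ.< e u w → SameSCC e w v → SameSCC e u v

GPositive : ∀ {n} → Multigraph n → Script n → Set
GPositive e σ = (σ ·Δ[ e ]) ≻ℤ 0ℤ

GStronglyPositive : ∀ {n} → Multigraph n → Script n → Set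
GStronglyPositive {n} e σ =
  GPositive e σ ×
  (∀ (v : Fin (suc n)) → IsSourceComponentOf e v →
     ∃ λ (i : Fin n) → SameSCC e (inject₁ i) v × (σ ·Δ[ e ]) i ≢ + 0)

IsMinStronglyPositive : ∀ {n} → Multigraph n → Script n → Set
IsMinStronglyPositive {n} e σ =
  GStronglyPositive e σ × (∀ (τ : Script n) → GStronglyPositive e τ → τ ≽ℕ σ)

-- The off-diagonal entries of Δ are non-positive, so (τΔ) j can only drop
-- when τ grows at vertices other than j.  Hence if τ ≻ 0 and a − τΔ ≥ 0 but
-- τ ⋠ σM, then τ ∸ σM is again such a script (because σMΔ ≥ 0) with smaller
-- sum (because σM ≥ 1 everywhere), and descent gives (ii) ⇒ (i).
-- For (iii) ⇒ (ii), if 0 ≺ τ ≼ σM and a − τΔ ≥ 0 is not stable, an active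
-- vertex j has τ j < σM j (otherwise (τΔ) j ≥ (σMΔ) j ≥ 0 would make j active
-- in a), and firing j once more keeps a − τΔ ≥ 0 while approaching σM.
-- Finally σM ≥ 1 everywhere holds for every strongly positive script: zeros
-- of σ propagate backwards along edges, and every vertex is reached from a
-- source component, on which σΔ does not vanish.
module Submission where

open import Defs
open import Data.Nat using (ℕ)
open import Data.Product using (_×_)
open import Function.Bundles using (_⇔_)
open import Relation.Nullary using (¬_)

open import Data.Fin using (Fin; zero; suc; inject₁; fromℕ; _≟_)
import Data.Fin.Properties as Fin
open import Data.Integer as ℤ using (ℤ; +_; -_; _+_; _-_; _*_; _≤_; +≤+)
import Data.Integer.Properties as ℤ
import Data.Nat as ℕ
open import Data.Nat using (_∸_)
open import Data.Nat.Induction using (<-wellFounded)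
import Data.Nat.Properties as ℕ
open import Data.Product using (∃-syntax; _,_; proj₁; proj₂)
open import Data.Sum using (_⊎_; inj₁; inj₂)
open import Function.Base using (_∘_)
open import Function.Bundles using (mk⇔)
open import Induction.WellFounded using (Acc; acc)
open import Relation.Binary.PropositionalEquality
open import Relation.Nullary using (Dec; yes; no; contradiction)
open import Relation.Nullary.Decidable
  using (_→-dec_; decidable-stable; ¬¬-excluded-middle)

open import Algebra.Properties.CommutativeSemigroup ℤ.+-commutativeSemigroup
  using (interchange)
open import Algebra.Properties.AbelianGroup ℤ.+-0-abelianGroup
  using (//-rightDividesˡ)

sumℤ-cong : ∀ {n} {f g : Fin n → ℤ} → (∀ i → f i ≡ g i) → sumℤ f ≡ sumℤ g
sumℤ-cong {ℕ.zero}  f≡g = refl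
sumℤ-cong {ℕ.suc n} f≡g = cong₂ _+_ (f≡g zero) (sumℤ-cong (f≡g ∘ suc))

sumℤ-+ : ∀ {n} (f g : Fin n → ℤ) → sumℤ (λ i → f i + g i) ≡ sumℤ f + sumℤ g
sumℤ-+ {ℕ.zero}  f g = refl
sumℤ-+ {ℕ.suc n} f g = begin
  (f zero + g zero) + sumℤ (λ i → f (suc i) + g (suc i))
    ≡⟨ cong (_+_ (f zero + g zero)) (sumℤ-+ (f ∘ suc) (g ∘ suc)) ⟩
  (f zero + g zero) + (sumℤ (f ∘ suc) + sumℤ (g ∘ suc))
    ≡⟨ interchange (f zero) (g zero) _ _ ⟩
  (f zero + sumℤ (f ∘ suc)) + (g zero + sumℤ (g ∘ suc)) ∎
  where open ≡-Reasoning

sumℤ-mono-≤ : ∀ {n} {f g : Fin n → ℤ} → (∀ i → f i ≤ g i) → sumℤ f ≤ sumℤ g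
sumℤ-mono-≤ {ℕ.zero}  f≤g = ℤ.≤-refl
sumℤ-mono-≤ {ℕ.suc n} f≤g = ℤ.+-mono-≤ (f≤g zero) (sumℤ-mono-≤ (f≤g ∘ suc))

sumℤ-zero : ∀ {n} {f : Fin n → ℤ} → (∀ i → f i ≡ + 0) → sumℤ f ≡ + 0
sumℤ-zero {ℕ.zero}  f≡0 = refl
sumℤ-zero {ℕ.suc n} f≡0 = cong₂ _+_ (f≡0 zero) (sumℤ-zero (f≡0 ∘ suc))

sumℤ-supported : ∀ {n} (f : Fin n → ℤ) k → (∀ i → i ≢ k → f i ≡ + 0) → sumℤ f ≡ f k
sumℤ-supported f zero    f≡0 =
  trans (cong (_+_ (f zero)) (sumℤ-zero (λ i → f≡0 (suc i) λ ()))) (ℤ.+-identityʳ (f zero))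
sumℤ-supported f (suc k) f≡0 =
  trans (cong (λ u → u + sumℤ (f ∘ suc)) (f≡0 zero λ ()))
        (trans (ℤ.+-identityˡ _)
               (sumℤ-supported (f ∘ suc) k (λ i i≢k → f≡0 (suc i) (i≢k ∘ Fin.suc-injective))))

sumℤ-nonpos : ∀ {n} {f : Fin n → ℤ} → (∀ i → f i ≤ + 0) → sumℤ f ≤ + 0
sumℤ-nonpos {ℕ.zero}  f≤0 = ℤ.≤-refl
sumℤ-nonpos {ℕ.suc n} f≤0 = ℤ.+-mono-≤ (f≤0 zero) (sumℤ-nonpos (f≤0 ∘ suc))

sumℤ-nonpos-≤-term : ∀ {n} {f : Fin n → ℤ} → (∀ i → f i ≤ + 0) → ∀ k → sumℤ f ≤ f k
sumℤ-nonpos-≤-term {f = f} f≤0 zero = begin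
  f zero + sumℤ (f ∘ suc) ≤⟨ ℤ.+-monoʳ-≤ (f zero) (sumℤ-nonpos (f≤0 ∘ suc)) ⟩
  f zero + + 0            ≡⟨ ℤ.+-identityʳ (f zero) ⟩
  f zero                  ∎
  where open ℤ.≤-Reasoning
sumℤ-nonpos-≤-term {f = f} f≤0 (suc k) = begin
  f zero + sumℤ (f ∘ suc) ≤⟨ ℤ.+-monoˡ-≤ (sumℤ (f ∘ suc)) (f≤0 zero) ⟩
  + 0 + sumℤ (f ∘ suc)    ≡⟨ ℤ.+-identityˡ _ ⟩
  sumℤ (f ∘ suc)          ≤⟨ sumℤ-nonpos-≤-term (f≤0 ∘ suc) k ⟩
  f (suc k)               ∎
  where open ℤ.≤-Reasoning

sumℕ-mono-≤ : ∀ {n} {f g : Fin n → ℕ} → (∀ i → f i ℕ.≤ g i) → sumℕ f ℕ.≤ sumℕ g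
sumℕ-mono-≤ {ℕ.zero}  f≤g = ℕ.z≤n
sumℕ-mono-≤ {ℕ.suc n} f≤g = ℕ.+-mono-≤ (f≤g zero) (sumℕ-mono-≤ (f≤g ∘ suc))

sumℕ-mono-< : ∀ {n} {f g : Fin n → ℕ} → (∀ i → f i ℕ.≤ g i) →
              ∀ k → f k ℕ.< g k → sumℕ f ℕ.< sumℕ g
sumℕ-mono-< {ℕ.suc n} f≤g zero    fk<gk = ℕ.+-mono-<-≤ fk<gk (sumℕ-mono-≤ (f≤g ∘ suc))
sumℕ-mono-< {ℕ.suc n} f≤g (suc k) fk<gk = ℕ.+-mono-≤-< (f≤g zero) (sumℕ-mono-< (f≤g ∘ suc) k fk<gk)

¬¬-descent : ∀ {A : Set} {P : A → Set} (μ : A → ℕ) →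
             (∀ {x} → P x → ¬ ¬ (∃[ y ] μ y ℕ.< μ x × P y)) → ∀ x → ¬ P x
¬¬-descent {P = P} μ descend x = go x (<-wellFounded (μ x))
  where
  go : ∀ x → Acc ℕ._<_ (μ x) → ¬ P x
  go x (acc rs) px = descend px λ (y , μy<μx , py) → go y (rs μy<μx) py

¬¬-Π-Fin : ∀ {m} {P : Fin m → Set} → (∀ i → ¬ ¬ P i) → ¬ ¬ (∀ i → P i)
¬¬-Π-Fin {ℕ.zero}  ¬¬P k = k λ ()
¬¬-Π-Fin {ℕ.suc m} ¬¬P k =
  ¬¬P zero λ p₀ → ¬¬-Π-Fin (¬¬P ∘ suc) λ ps → k λ { zero → p₀ ; (suc i) → ps i }

indicator : ∀ {A : Set} → Dec A → ℕ
indicator (yes _) = 1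
indicator (no _)  = 0

indicator-mono : ∀ {A B : Set} (a? : Dec A) (b? : Dec B) → (A → B) →
                 indicator a? ℕ.≤ indicator b?
indicator-mono (yes a) (yes _) A→B = ℕ.≤-refl
indicator-mono (yes a) (no ¬b) A→B = contradiction (A→B a) ¬b
indicator-mono (no _)  b?      A→B = ℕ.z≤n

indicator-< : ∀ {A B : Set} (a? : Dec A) (b? : Dec B) → ¬ A → B →
              indicator a? ℕ.< indicator b?
indicator-< (yes a) b?      ¬a b = contradiction a ¬a
indicator-< (no _)  (yes _) ¬a b = ℕ.s≤s ℕ.z≤n
indicator-< (no _)  (no ¬b) ¬a b = contradiction b ¬b

positive-entry⇒≻0 : ∀ {n} {σ : Script n} i → 0 ℕ.< σ i → σ ≻ℕ 0ℕ
positive-entry⇒≻0 i σᵢ>0 = (λ _ → ℕ.z≤n) , λ σ≡0 → ℕ.<⇒≢ σᵢ>0 (sym (σ≡0 i))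

unit : ∀ {n} → Fin n → Script n
unit k i with k ≟ i
... | yes _ = 1
... | no  _ = 0

unit-self : ∀ {n} (k : Fin n) → unit k k ≡ 1
unit-self k with k ≟ k
... | yes _   = refl
... | no  k≢k = contradiction refl k≢k

unit-other : ∀ {n} {k i : Fin n} → k ≢ i → unit k i ≡ 0
unit-other {k = k} {i} k≢i with k ≟ i
... | yes k≡i = contradiction k≡i k≢i
... | no  _   = refl

fire : ∀ {n} → Fin n → Script n → Script n
fire j τ i = unit j i ℕ.+ τ i

fire-≻0 : ∀ {n} j (τ : Script n) → fire j τ ≻ℕ 0ℕ
fire-≻0 j τ = positive-entry⇒≻0 j (subst (λ u → 0 ℕ.< u ℕ.+ τ j) (sym (unit-self j)) (ℕ.s≤s ℕ.z≤n))

fire-≼ : ∀ {n} {j} {σ τ : Script n} → τ j ℕ.< σ j → σ ≽ℕ τ → σ ≽ℕ fire j τ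
fire-≼ {j = j} τj<σj τ≤σ i with j ≟ i
... | yes refl = τj<σj
... | no  _    = τ≤σ i

fire-deficit-< : ∀ {n} {j} {σ τ : Script n} → τ j ℕ.< σ j →
                 sumℕ (λ i → σ i ∸ fire j τ i) ℕ.< sumℕ (λ i → σ i ∸ τ i)
fire-deficit-< {j = j} {σ} {τ} τj<σj =
  sumℕ-mono-< (λ i → ℕ.∸-monoʳ-≤ (σ i) (ℕ.m≤n+m (τ i) (unit j i))) j
    (subst (λ u → σ j ∸ (u ℕ.+ τ j) ℕ.< σ j ∸ τ j) (sym (unit-self j))
      (ℕ.∸-monoʳ-< (ℕ.n<1+n (τ j)) τj<σj))

HasNegative⇒¬NonNeg : ∀ {n} {c : Config n} → HasNegative c → ¬ NonNeg c
HasNegative⇒¬NonNeg (i , cᵢ<0) c≥0 = ℤ.<⇒≱ cᵢ<0 (c≥0 i)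

HasNegative? : ∀ {n} (c : Config n) → Dec (HasNegative c)
HasNegative? c = Fin.any? (λ i → c i ℤ.<? + 0)

Reach-trans : ∀ {n} {e : Multigraph n} {u v w} → Reach e u v → Reach e v w → Reach e u w
Reach-trans here        v↝w = v↝w
Reach-trans (step p u↝v) v↝w = step p (Reach-trans u↝v v↝w)

fromℕ-or-inject₁ : ∀ {m} (x : Fin (ℕ.suc m)) → x ≡ fromℕ m ⊎ ∃[ i ] x ≡ inject₁ i
fromℕ-or-inject₁ {ℕ.zero}  zero    = inj₁ refl
fromℕ-or-inject₁ {ℕ.suc m} zero    = inj₂ (zero , refl)
fromℕ-or-inject₁ {ℕ.suc m} (suc x) with fromℕ-or-inject₁ x
... | inj₁ x≡top      = inj₁ (cong suc x≡top)
... | inj₂ (i , x≡i)  = inj₂ (suc i , cong suc x≡i)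

+*-neg : ∀ m k → + m * - + k ≡ - + (m ℕ.* k)
+*-neg m k = trans (sym (ℤ.neg-distribʳ-* (+ m) (+ k))) (cong -_ (sym (ℤ.pos-* m k)))

0≤-+⇒≡0 : ∀ m → + 0 ≤ - + m → m ≡ 0
0≤-+⇒≡0 ℕ.zero    _  = refl
0≤-+⇒≡0 (ℕ.suc m) ()

module _ {n : ℕ} (e : Multigraph n) where

  Laplacian-diag : ∀ i → Laplacian e i i ≡ + outdeg e i
  Laplacian-diag i with i ≟ i
  ... | yes _   = refl
  ... | no  i≢i = contradiction refl i≢i

  Laplacian-offdiag : ∀ {i j} → i ≢ j → Laplacian e i j ≡ - + e (inject₁ i) (inject₁ j)
  Laplacian-offdiag {i} {j} i≢j with i ≟ j
  ... | yes i≡j = contradiction i≡j i≢j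
  ... | no  _   = refl

  Laplacian-offdiag-nonpos : ∀ {i j} → i ≢ j → Laplacian e i j ≤ + 0
  Laplacian-offdiag-nonpos i≢j = subst (_≤ + 0) (sym (Laplacian-offdiag i≢j)) ℤ.neg-≤-pos

  ·Δ-+ : ∀ (σ τ : Script n) j →
         ((λ i → σ i ℕ.+ τ i) ·Δ[ e ]) j ≡ (σ ·Δ[ e ]) j + (τ ·Δ[ e ]) j
  ·Δ-+ σ τ j = trans (sumℤ-cong (λ i → ℤ.*-distribʳ-+ (Laplacian e i j) (+ σ i) (+ τ i)))
                     (sumℤ-+ (λ i → + σ i * Laplacian e i j) (λ i → + τ i * Laplacian e i j))

  ·Δ-unit : ∀ k j → (unit k ·Δ[ e ]) j ≡ Laplacian e k j
  ·Δ-unit k j = begin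
    (unit k ·Δ[ e ]) j           ≡⟨ sumℤ-supported _ k (λ i i≢k → cong (λ u → + u * Laplacian e i j)
                                                              (unit-other (i≢k ∘ sym))) ⟩
    + unit k k * Laplacian e k j ≡⟨ cong (λ u → + u * Laplacian e k j) (unit-self k) ⟩
    + 1 * Laplacian e k j        ≡⟨ ℤ.*-identityˡ _ ⟩
    Laplacian e k j              ∎
    where open ≡-Reasoning

  0·Δ : ∀ j → (0ℕ ·Δ[ e ]) j ≡ + 0
  0·Δ j = sumℤ-zero {n} (λ _ → refl)

  ·Δ-antitone : ∀ {σ τ : Script n} {j} → τ ≽ℕ σ → σ j ≡ τ j →
                (τ ·Δ[ e ]) j ≤ (σ ·Δ[ e ]) j
  ·Δ-antitone {σ} {τ} {j} σ≤τ σj≡τj = sumℤ-mono-≤ (λ i → term i (i ≟ j))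
    where
    term : ∀ i → Dec (i ≡ j) → + τ i * Laplacian e i j ≤ + σ i * Laplacian e i j
    term i (yes refl) = ℤ.≤-reflexive (cong (λ u → + u * Laplacian e i i) (sym σj≡τj))
    term i (no i≢j)   = ℤ.*-monoʳ-≤-nonPos (Laplacian e i j)
                          {{ℤ.nonPositive (Laplacian-offdiag-nonpos i≢j)}} (+≤+ (σ≤τ i))

  module _ {σ : Script n} (σΔ≥0 : NonNeg (σ ·Δ[ e ])) {j : Fin n} (σj≡0 : σ j ≡ 0) where

    private
      term-nonpos : ∀ i → + σ i * Laplacian e i j ≤ + 0
      term-nonpos i = term-nonpos′ i (i ≟ j)
        where
        term-nonpos′ : ∀ i → Dec (i ≡ j) → + σ i * Laplacian e i j ≤ + 0
        term-nonpos′ i (yes refl) = ℤ.≤-reflexive (cong (λ u → + u * Laplacian e i i) σj≡0)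
        term-nonpos′ i (no i≢j)   =
          ℤ.≤-trans (ℤ.*-monoˡ-≤-nonNeg (+ σ i) (Laplacian-offdiag-nonpos i≢j))
                    (ℤ.≤-reflexive (ℤ.*-zeroʳ (+ σ i)))

    ·Δ-vanishes-at-zero : (σ ·Δ[ e ]) j ≡ + 0
    ·Δ-vanishes-at-zero = ℤ.≤-antisym (sumℤ-nonpos term-nonpos) (σΔ≥0 j)

    zero-at-in-neighbour : ∀ i → 0 ℕ.< e (inject₁ i) (inject₁ j) → σ i ≡ 0
    zero-at-in-neighbour i e>0 with i ≟ j
    ... | yes refl = σj≡0
    ... | no  i≢j  = ℕ.m*n≡0⇒m≡0 (σ i) _ {{ℕ.>-nonZero e>0}} (0≤-+⇒≡0 _ (begin
      + 0                        ≤⟨ σΔ≥0 j ⟩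
      (σ ·Δ[ e ]) j              ≤⟨ sumℤ-nonpos-≤-term term-nonpos i ⟩
      + σ i * Laplacian e i j    ≡⟨ cong (+ σ i *_) (Laplacian-offdiag i≢j) ⟩
      + σ i * - + e (inject₁ i) (inject₁ j) ≡⟨ +*-neg (σ i) _ ⟩
      - + (σ i ℕ.* e (inject₁ i) (inject₁ j)) ∎))
      where open ℤ.≤-Reasoning

  Fits : Config n → Script n → Set
  Fits a σ = ∀ i → (σ ·Δ[ e ]) i ≤ a i

  Fits⇒NonNeg : ∀ {a σ} → Fits a σ → NonNeg (a ⊖ (σ ·Δ[ e ]))
  Fits⇒NonNeg fits i = ℤ.i≤j⇒0≤j-i (fits i)

  Fits⇒¬HasNegative : ∀ {a σ} → Fits a σ → ¬ HasNegative (a ⊖ (σ ·Δ[ e ]))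
  Fits⇒¬HasNegative {a} {σ} fits neg = HasNegative⇒¬NonNeg neg (Fits⇒NonNeg {a} {σ} fits)

  ¬Fits⇒HasNegative : ∀ {a σ} → ¬ Fits a σ → HasNegative (a ⊖ (σ ·Δ[ e ]))
  ¬Fits⇒HasNegative {a} {σ} ¬fits = decidable-stable (HasNegative? (a ⊖ (σ ·Δ[ e ]))) λ ¬neg →
    ¬fits λ i → ℤ.0≤i-j⇒j≤i (ℤ.≮⇒≥ λ <0 → ¬neg (i , <0))

  Fits-∸ : ∀ {a σ τ} → NonNeg a → NonNeg (σ ·Δ[ e ]) → Fits a τ →
           Fits a (λ i → τ i ∸ σ i)
  Fits-∸ {a} {σ} {τ} a≥0 σΔ≥0 fits j with σ j ℕ.≤? τ j
  ... | yes σj≤τj = begin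
    (ρ ·Δ[ e ]) j                         ≤⟨ ℤ.i≤j+i _ _ {{ℤ.nonNegative (σΔ≥0 j)}} ⟩
    (σ ·Δ[ e ]) j + (ρ ·Δ[ e ]) j         ≡⟨ sym (·Δ-+ σ ρ j) ⟩
    ((λ i → σ i ℕ.+ ρ i) ·Δ[ e ]) j       ≤⟨ ·Δ-antitone (λ i → ℕ.m≤n+m∸n (τ i) (σ i))
                                                          (sym (ℕ.m+[n∸m]≡n σj≤τj)) ⟩
    (τ ·Δ[ e ]) j                         ≤⟨ fits j ⟩
    a j                                   ∎
    where
    open ℤ.≤-Reasoning
    ρ : Script n
    ρ i = τ i ∸ σ i
  ... | no  σj≰τj = begin
    ((λ i → τ i ∸ σ i) ·Δ[ e ]) j       ≤⟨ ·Δ-antitone {0ℕ} {λ i → τ i ∸ σ i} (λ _ → ℕ.z≤n)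
                                               (sym (ℕ.m≤n⇒m∸n≡0 (ℕ.<⇒≤ (ℕ.≰⇒> σj≰τj)))) ⟩
    (0ℕ ·Δ[ e ]) j                        ≡⟨ 0·Δ j ⟩
    + 0                                   ≤⟨ a≥0 j ⟩
    a j                                   ∎
    where open ℤ.≤-Reasoning

  Fits-fire : ∀ {a τ j} → Fits a τ → + outdeg e j ≤ (a ⊖ (τ ·Δ[ e ])) j → Fits a (fire j τ)
  Fits-fire {a} {τ} {j} fits active x with x ≟ j
  ... | yes refl = begin
    (fire x τ ·Δ[ e ]) x                  ≡⟨ ·Δ-+ (unit x) τ x ⟩
    (unit x ·Δ[ e ]) x + (τ ·Δ[ e ]) x    ≡⟨ cong (λ u → u + (τ ·Δ[ e ]) x)
                                                  (trans (·Δ-unit x x) (Laplacian-diag x)) ⟩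
    + outdeg e x + (τ ·Δ[ e ]) x          ≤⟨ ℤ.+-monoˡ-≤ ((τ ·Δ[ e ]) x) active ⟩
    a x - (τ ·Δ[ e ]) x + (τ ·Δ[ e ]) x   ≡⟨ //-rightDividesˡ ((τ ·Δ[ e ]) x) (a x) ⟩
    a x                                   ∎
    where open ℤ.≤-Reasoning
  ... | no  x≢j  = begin
    (fire j τ ·Δ[ e ]) x                  ≡⟨ ·Δ-+ (unit j) τ x ⟩
    (unit j ·Δ[ e ]) x + (τ ·Δ[ e ]) x    ≡⟨ cong (λ u → u + (τ ·Δ[ e ]) x) (·Δ-unit j x) ⟩
    Laplacian e j x + (τ ·Δ[ e ]) x       ≤⟨ ℤ.+-monoˡ-≤ ((τ ·Δ[ e ]) x)
                                                  (Laplacian-offdiag-nonpos (x≢j ∘ sym)) ⟩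
    + 0 + (τ ·Δ[ e ]) x                   ≡⟨ ℤ.+-identityˡ _ ⟩
    (τ ·Δ[ e ]) x                         ≤⟨ fits x ⟩
    a x                                   ∎
    where open ℤ.≤-Reasoning

  zero-spreads-backwards : (∀ v → e (sink n) v ≡ 0) →
                           ∀ {σ} → NonNeg (σ ·Δ[ e ]) → ∀ {j} → σ j ≡ 0 →
                           ∀ {u} → Reach e u (inject₁ j) → ∃[ i ] u ≡ inject₁ i × σ i ≡ 0
  zero-spreads-backwards _ _ {j} σj≡0 here = j , refl , σj≡0
  zero-spreads-backwards sink-silent σΔ≥0 σj≡0 {u} (step {x = x} u→x x↝j)
    with zero-spreads-backwards sink-silent σΔ≥0 σj≡0 x↝j
  ... | i′ , refl , σi′≡0 with fromℕ-or-inject₁ u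
  ...   | inj₁ refl       = contradiction (sym (sink-silent x)) (ℕ.<⇒≢ u→x)
  ...   | inj₂ (i , refl) = i , refl , zero-at-in-neighbour σΔ≥0 σi′≡0 i u→x

  -- Rather than deciding reachability, GStronglyPositive⇒nonzero takes a
  -- decision procedure from ¬ ¬, which is sound because it proves a negation.
  ReachDecidable : Set
  ReachDecidable = ∀ u v → Dec (Reach e u v)

  ¬¬ReachDecidable : ¬ ¬ ReachDecidable
  ¬¬ReachDecidable = ¬¬-Π-Fin λ u → ¬¬-Π-Fin λ v → ¬¬-excluded-middle

  module _ (reach? : ReachDecidable) where

    reachers : Fin (ℕ.suc n) → ℕ
    reachers v = sumℕ λ u → indicator (reach? u v)

    reachers-< : ∀ {u v} → Reach e u v → ¬ Reach e v u → reachers u ℕ.< reachers v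
    reachers-< {u} {v} u↝v v↛u =
      sumℕ-mono-< (λ w → indicator-mono (reach? w u) (reach? w v) (λ w↝u → Reach-trans w↝u u↝v))
                  v (indicator-< (reach? v u) (reach? v v) v↛u here)

    source-or-escape : ∀ v → IsSourceComponentOf e v ⊎ ∃[ u ] Reach e u v × ¬ Reach e v u
    source-or-escape v with Fin.all? (λ u → reach? u v →-dec reach? v u)
    ... | yes closed = inj₁ λ u w u→w (w↝v , _) → step u→w w↝v , closed u (step u→w w↝v)
    ... | no ¬closed with Fin.¬∀⟶∃¬ _ _ (λ u → reach? u v →-dec reach? v u) ¬closed
    ...   | u , ¬[u↝v⇒v↝u] =
      inj₂ (u , decidable-stable (reach? u v) (λ u↛v → ¬[u↝v⇒v↝u] λ u↝v → contradiction u↝v u↛v)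
              , λ v↝u → ¬[u↝v⇒v↝u] λ _ → v↝u)

  GStronglyPositive⇒nonzero : GlobalSink e → ∀ {σ} → GStronglyPositive e σ → ∀ j → σ j ≢ 0
  GStronglyPositive⇒nonzero (sink-silent , _) {σ} ((σΔ≥0 , _) , strong) j σj≡0 =
    ¬¬ReachDecidable λ reach? →
      ¬¬-descent {P = λ v → Reach e v (inject₁ j)}
                 (reachers reach?) (ascend reach?) (inject₁ j) here
    where
    ascend : ∀ reach? {v} → Reach e v (inject₁ j) →
             ¬ ¬ (∃[ u ] reachers reach? u ℕ.< reachers reach? v × Reach e u (inject₁ j))
    ascend reach? {v} v↝j next with source-or-escape reach? v
    ... | inj₂ (u , u↝v , v↛u) = next (u , reachers-< reach? u↝v v↛u , Reach-trans u↝v v↝j)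
    ... | inj₁ source with strong v source
    ...   | i , (i↝v , _) , σΔi≢0
      with zero-spreads-backwards sink-silent {σ} σΔ≥0 σj≡0 (Reach-trans i↝v v↝j)
    ...     | i′ , i≡i′ , σi′≡0 with Fin.inject₁-injective i≡i′
    ...       | refl = σΔi≢0 (·Δ-vanishes-at-zero {σ} σΔ≥0 σi′≡0)

  negative-below⇒superstable :
    ∀ {σM a} → (∀ i → σM i ≢ 0) → NonNeg (σM ·Δ[ e ]) → NonNeg a →
    (∀ σ → σ ≻ℕ 0ℕ → σM ≽ℕ σ → HasNegative (a ⊖ (σ ·Δ[ e ]))) → Superstable e a
  negative-below⇒superstable {σM} {a} σM≢0 σMΔ≥0 a≥0 negative-below =
    a≥0 , λ σ σ≻0 → ¬Fits⇒HasNegative {a} {σ} λ fits →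
      ¬¬-descent {P = λ τ → τ ≻ℕ 0ℕ × Fits a τ} sumℕ shrink σ (σ≻0 , fits)
    where
    shrink : ∀ {τ} → τ ≻ℕ 0ℕ × Fits a τ →
             ¬ ¬ (∃[ ρ ] sumℕ ρ ℕ.< sumℕ τ × ρ ≻ℕ 0ℕ × Fits a ρ)
    shrink {τ} (τ≻0 , fits) next with Fin.all? (λ i → τ i ℕ.≤? σM i)
    ... | yes τ≤σM = Fits⇒¬HasNegative {a} {τ} fits (negative-below τ τ≻0 τ≤σM)
    ... | no  τ≰σM with Fin.¬∀⟶∃¬ n _ (λ i → τ i ℕ.≤? σM i) τ≰σM
    ...   | i , τi≰σMi =
      next (ρ , sumℕ-mono-< (λ k → ℕ.m∸n≤m (τ k) (σM k)) i ρi<τi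
              , positive-entry⇒≻0 i (ℕ.m<n⇒0<n∸m σMi<τi) , Fits-∸ {a} {σM} {τ} a≥0 σMΔ≥0 fits)
      where
      ρ : Script n
      ρ k = τ k ∸ σM k
      σMi<τi : σM i ℕ.< τ i
      σMi<τi = ℕ.≰⇒> τi≰σMi
      ρi<τi : ρ i ℕ.< τ i
      ρi<τi = ℕ.∸-monoʳ-< (ℕ.n≢0⇒n>0 (σM≢0 i)) (ℕ.<⇒≤ σMi<τi)

  active⇒unsaturated : ∀ {σM τ a j} → NonNeg (σM ·Δ[ e ]) → Stable e a → σM ≽ℕ τ →
                       + outdeg e j ≤ (a ⊖ (τ ·Δ[ e ])) j → τ j ℕ.< σM j
  active⇒unsaturated {σM} {τ} {a} {j} σMΔ≥0 (_ , a<d) τ≤σM active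
    with ℕ.m≤n⇒m<n∨m≡n (τ≤σM j)
  ... | inj₁ τj<σMj = τj<σMj
  ... | inj₂ τj≡σMj = contradiction (begin
    + outdeg e j             ≤⟨ active ⟩
    a j - (τ ·Δ[ e ]) j      ≤⟨ ℤ.i-j≤i (a j) _ {{ℤ.nonNegative τΔj≥0}} ⟩
    a j                      ∎) (ℤ.<⇒≱ (a<d j))
    where
    open ℤ.≤-Reasoning
    τΔj≥0 : + 0 ≤ (τ ·Δ[ e ]) j
    τΔj≥0 = ℤ.≤-trans (σMΔ≥0 j) (·Δ-antitone τ≤σM τj≡σMj)

  unstable-below⇒negative-below :
    ∀ {σM a} → NonNeg (σM ·Δ[ e ]) → Stable e a →
    (∀ σ → σ ≻ℕ 0ℕ → σM ≽ℕ σ → ¬ Stable e (a ⊖ (σ ·Δ[ e ]))) →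
    (∀ σ → σ ≻ℕ 0ℕ → σM ≽ℕ σ → HasNegative (a ⊖ (σ ·Δ[ e ])))
  unstable-below⇒negative-below {σM} {a} σMΔ≥0 a-stable unstable-below σ σ≻0 σ≤σM =
    ¬Fits⇒HasNegative {a} {σ} λ fits →
      ¬¬-descent {P = λ τ → τ ≻ℕ 0ℕ × σM ≽ℕ τ × Fits a τ} deficit grow σ (σ≻0 , σ≤σM , fits)
    where
    deficit : Script n → ℕ
    deficit τ = sumℕ (λ i → σM i ∸ τ i)
    grow : ∀ {τ} → τ ≻ℕ 0ℕ × σM ≽ℕ τ × Fits a τ →
           ¬ ¬ (∃[ τ′ ] deficit τ′ ℕ.< deficit τ × τ′ ≻ℕ 0ℕ × σM ≽ℕ τ′ × Fits a τ′)
    grow {τ} (τ≻0 , τ≤σM , fits) next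
      with Fin.all? (λ i → (a ⊖ (τ ·Δ[ e ])) i ℤ.<? + outdeg e i)
    ... | yes subcritical = unstable-below τ τ≻0 τ≤σM (Fits⇒NonNeg {a} {τ} fits , subcritical)
    ... | no ¬subcritical
      with Fin.¬∀⟶∃¬ n _ (λ i → (a ⊖ (τ ·Δ[ e ])) i ℤ.<? + outdeg e i) ¬subcritical
    ...   | j , ¬j-subcritical =
      next (fire j τ , fire-deficit-< {n} {j} {σM} {τ} τj<σMj , fire-≻0 j τ
           , fire-≼ τj<σMj τ≤σM , Fits-fire {a} {τ} {j} fits active)
      where
      active : + outdeg e j ≤ (a ⊖ (τ ·Δ[ e ])) j
      active = ℤ.≮⇒≥ ¬j-subcritical
      τj<σMj : τ j ℕ.< σM j
      τj<σMj = active⇒unsaturated σMΔ≥0 a-stable τ≤σM active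

corollary1 : ∀ (n : ℕ) (e : Multigraph n) → NoLoops e → GlobalSink e →
    ∀ (σM : Script n) → IsMinStronglyPositive e σM →
    ∀ (a : Config n) → Stable e a →
      (Superstable e a ⇔
        (∀ (σ : Script n) → σ ≻ℕ 0ℕ → σM ≽ℕ σ → HasNegative (a ⊖ (σ ·Δ[ e ]))))
      ×
      ((∀ (σ : Script n) → σ ≻ℕ 0ℕ → σM ≽ℕ σ → HasNegative (a ⊖ (σ ·Δ[ e ]))) ⇔
        (∀ (σ : Script n) → σ ≻ℕ 0ℕ → σM ≽ℕ σ → ¬ Stable e (a ⊖ (σ ·Δ[ e ]))))
corollary1 n e _ global-sink σM (σM-strong , _) a a-stable =
    mk⇔ (λ superstable σ σ≻0 _ → proj₂ superstable σ σ≻0)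
        (negative-below⇒superstable e σM≢0 σMΔ≥0 (proj₁ a-stable))
  , mk⇔ (λ negative-below σ σ≻0 σ≤σM stable →
           HasNegative⇒¬NonNeg (negative-below σ σ≻0 σ≤σM) (proj₁ stable))
        (unstable-below⇒negative-below e σMΔ≥0 a-stable)
  where
  σMΔ≥0 : NonNeg (σM ·Δ[ e ])
  σMΔ≥0 = proj₁ (proj₁ σM-strong)
  σM≢0 : ∀ i → σM i ≢ 0
  σM≢0 = GStronglyPositive⇒nonzero e global-sink σM-strong
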